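{- Let $d,N\ge1$ be integers, let $\mathcal V=\{0,N\}^d$ be the set of vertices of $[0,N]^d$, and let $\mathbf a=(a_1,\dots,a_d)\in\mathbb R^d$. With $A_{\mathbf a,\mathcal V}(d,N)=\frac{1}{\#\mathcal V}\sum_{\mathbf v\in\mathcal V}\operatorname{dist}^2(\mathbf v,\mathbf a)$, $$\frac{1}{\#\mathcal V}\sum_{\mathbf v\in\mathcal V}\bigl(\operatorname{dist}^2(\mathbf v,\mathbf a)-A_{\mathbf a,\mathcal V}(d,N)\bigr)^2=\frac14 dN^4-\sigma(\mathbf a)N^3+\|\mathbf a\|^2N^2,$$ where $\sigma(\mathbf a)=a_1+\cdots+a_d$ and $\|\mathbf a\|^2=a_1^2+\cdots+a_d^2$.
   Context: $\operatorname{dist}$ denotes the Euclidean distance in $\mathbb R^d$. -}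

module Defs where

open import Level using (Level)
open import Data.Nat using (ℕ; zero; suc)
open import Data.Fin using (Fin) renaming (zero to fzero; suc to fsuc)
open import Data.Bool using (Bool; true; false; if_then_else_)
open import Data.Vec.Functional using (Vector; _∷_; [])
open import Algebra.Bundles using (CommutativeRing)

-- Everything is developed over a commutative ring R (playing the role of ℝ).
module Cube {c ℓ : Level} (R : CommutativeRing c ℓ) where
  open CommutativeRing R

  ⟦_⟧ : ℕ → Carrier
  ⟦ zero ⟧  = 0#
  ⟦ suc n ⟧ = 1# + ⟦ n ⟧

  _^_ : Carrier → ℕ → Carrier
  x ^ zero  = 1#
  x ^ suc n = x * (x ^ n)

  Σ : (d : ℕ) → (Fin d → Carrier) → Carrier
  Σ zero    f = 0#
  Σ (suc d) f = f fzero + Σ d (λ i → f (fsuc i))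

  Point : ℕ → Set c
  Point d = Vector Carrier d

  -- A vertex of [0,N]^d, i.e. an element of {0,N}^d, encoded by the
  -- choice (false ↦ 0, true ↦ N) in each coordinate.
  Vertex : ℕ → Set
  Vertex d = Vector Bool d

  vertex : (d N : ℕ) → Vertex d → Point d
  vertex d N v i = if v i then ⟦ N ⟧ else 0#

  ΣV : (d : ℕ) → (Vertex d → Carrier) → Carrier
  ΣV zero    f = f []
  ΣV (suc d) f = ΣV d (λ v → f (false ∷ v)) + ΣV d (λ v → f (true ∷ v))

  dist² : (d : ℕ) → Point d → Point d → Carrier
  dist² d x y = Σ d (λ i → (x i - y i) * (x i - y i))

  σ : (d : ℕ) → Point d → Carrier
  σ d a = Σ d a

  ‖_‖² : {d : ℕ} → Point d → Carrier
  ‖_‖² {d} a = Σ d (λ i → a i * a i)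

  -- Given h with 2·h = 1 (so h = 1/2), 1/#V = 1/2^d = h^d.
  -- A_{a,V}(d,N) = (1/#V) Σ_{v∈V} dist²(v,a)
  A : (h : Carrier) (d N : ℕ) → Point d → Carrier
  A h d N a = (h ^ d) * ΣV d (λ v → dist² d (vertex d N v) a)

  Var : (h : Carrier) (d N : ℕ) → Point d → Carrier
  Var h d N a = (h ^ d) * ΣV d (λ v →
      (dist² d (vertex d N v) a - A h d N a) * (dist² d (vertex d N v) a - A h d N a))

-- Under the uniform distribution on the 2^d vertices the coordinates are independent fair coins,
-- and dist²(v, a) = Σᵢ (vᵢ - aᵢ)² is a sum of functions of single coordinates, so its variance
-- is the sum of the coordinate variances.  The i-th summand takes the values aᵢ² and (N - aᵢ)²,
-- each with probability 1/2, so its variance is ((N - aᵢ)² - aᵢ²)²/4 = N⁴/4 - aᵢN³ + aᵢ²N².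
module Submission where

open import Defs
open import Level using (Level)
open import Data.Nat using (ℕ; zero; suc; _≤_; z≤n)
import Data.Nat as ℕ
open import Data.Nat.Properties using (+-suc)
open import Data.Integer as ℤ using (ℤ; +_; -[1+_]; _⊖_)
open import Data.Integer.Properties using (⊖-≥; [1+m]⊖[1+n]≡m⊖n)
open import Data.Sign as Sign using (Sign)
open import Data.Maybe using (Maybe; just; nothing)
import Relation.Binary.PropositionalEquality as ≡
open import Relation.Nullary using (yes; no)
open import Algebra.Bundles using (CommutativeRing)

-- The library solvers for an arbitrary commutative ring take coefficients in ℕ (no subtraction)
-- or in the ring itself (where x - x does not normalise to 0), hence integer coefficients.
module IntegerCoefficientSolver {c ℓ : Level} (R : CommutativeRing c ℓ) where
  open CommutativeRing R
  open import Algebra.Properties.Ring ring using (-0#≈0#; -‿involutive; -‿+-comm; -‿distribˡ-*; -‿distribʳ-*)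
  open import Algebra.Properties.CommutativeSemigroup +-commutativeSemigroup using (interchange)
  open import Algebra.Properties.Semiring.Mult.TCOptimised semiring using (_×_; 1+×; ×-homo-+; ×1-homo-*)
  open import Algebra.Solver.Ring.AlmostCommutativeRing using (fromCommutativeRing; _-Raw-AlmostCommutative⟶_)
  open import Relation.Binary.Reasoning.Setoid setoid

  signed : Sign → Carrier → Carrier
  signed Sign.+ x = x
  signed Sign.- x = - x

  signed-cong : ∀ s {x y} → x ≈ y → signed s x ≈ signed s y
  signed-cong Sign.+ x≈y = x≈y
  signed-cong Sign.- x≈y = -‿cong x≈y

  signed-* : ∀ s t x y → signed (s Sign.* t) (x * y) ≈ signed s x * signed t y
  signed-* Sign.+ Sign.+ x y = refl
  signed-* Sign.+ Sign.- x y = -‿distribʳ-* x y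
  signed-* Sign.- Sign.+ x y = -‿distribˡ-* x y
  signed-* Sign.- Sign.- x y = begin
    x * y         ≈⟨ -‿involutive (x * y) ⟨
    - - (x * y)   ≈⟨ -‿cong (-‿distribˡ-* x y) ⟩
    - (- x * y)   ≈⟨ -‿distribʳ-* (- x) y ⟩
    - x * - y     ∎

  fromℤ : ℤ → Carrier
  fromℤ i = signed (ℤ.sign i) (ℤ.∣ i ∣ × 1#)

  fromℤ-◃ : ∀ s n → fromℤ (s ℤ.◃ n) ≈ signed s (n × 1#)
  fromℤ-◃ Sign.+ zero    = refl
  fromℤ-◃ Sign.- zero    = sym -0#≈0#
  fromℤ-◃ Sign.+ (suc n) = refl
  fromℤ-◃ Sign.- (suc n) = refl

  fromℤ-* : ∀ i j → fromℤ (i ℤ.* j) ≈ fromℤ i * fromℤ j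
  fromℤ-* i j = begin
    fromℤ (s ℤ.◃ ℤ.∣ i ∣ ℕ.* ℤ.∣ j ∣)          ≈⟨ fromℤ-◃ s (ℤ.∣ i ∣ ℕ.* ℤ.∣ j ∣) ⟩
    signed s ((ℤ.∣ i ∣ ℕ.* ℤ.∣ j ∣) × 1#)       ≈⟨ signed-cong s (×1-homo-* ℤ.∣ i ∣ ℤ.∣ j ∣) ⟩
    signed s ((ℤ.∣ i ∣ × 1#) * (ℤ.∣ j ∣ × 1#))  ≈⟨ signed-* (ℤ.sign i) (ℤ.sign j) _ _ ⟩
    fromℤ i * fromℤ j                           ∎
    where s = ℤ.sign i Sign.* ℤ.sign j

  fromℤ-⊖ : ∀ m n → fromℤ (m ⊖ n) ≈ m × 1# - n × 1#
  fromℤ-⊖ m zero = begin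
    fromℤ (m ⊖ 0)   ≡⟨ ≡.cong fromℤ (⊖-≥ {m} z≤n) ⟩
    m × 1#          ≈⟨ +-identityʳ (m × 1#) ⟨
    m × 1# + 0#     ≈⟨ +-congˡ -0#≈0# ⟨
    m × 1# - 0#     ∎
  fromℤ-⊖ zero (suc n) = sym (+-identityˡ _)
  fromℤ-⊖ (suc m) (suc n) = begin
    fromℤ (suc m ⊖ suc n)                  ≡⟨ ≡.cong fromℤ ([1+m]⊖[1+n]≡m⊖n m n) ⟩
    fromℤ (m ⊖ n)                          ≈⟨ fromℤ-⊖ m n ⟩
    m × 1# - n × 1#                        ≈⟨ cancel-+ˡ 1# (m × 1#) (n × 1#) ⟨
    (1# + m × 1#) - (1# + n × 1#)          ≈⟨ +-cong (1+× m 1#) (-‿cong (1+× n 1#)) ⟨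
    suc m × 1# - suc n × 1#                ∎
    where
    cancel-+ˡ : ∀ z x y → (z + x) - (z + y) ≈ x - y
    cancel-+ˡ z x y = begin
      (z + x) - (z + y)      ≈⟨ +-congˡ (-‿+-comm z y) ⟨
      (z + x) + (- z - y)    ≈⟨ interchange z x (- z) (- y) ⟩
      (z - z) + (x - y)      ≈⟨ +-congʳ (-‿inverseʳ z) ⟩
      0# + (x - y)           ≈⟨ +-identityˡ (x - y) ⟩
      x - y                  ∎

  fromℤ-+ : ∀ i j → fromℤ (i ℤ.+ j) ≈ fromℤ i + fromℤ j
  fromℤ-+ -[1+ m ] -[1+ n ] = begin
    - (suc (suc (m ℕ.+ n)) × 1#)           ≡⟨ ≡.cong (λ k → - (k × 1#)) (≡.cong suc (+-suc m n)) ⟨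
    - ((suc m ℕ.+ suc n) × 1#)             ≈⟨ -‿cong (×-homo-+ 1# (suc m) (suc n)) ⟩
    - (suc m × 1# + suc n × 1#)            ≈⟨ -‿+-comm _ _ ⟨
    - (suc m × 1#) - suc n × 1#            ∎
  fromℤ-+ -[1+ m ] (+ n)    = trans (fromℤ-⊖ n (suc m)) (+-comm _ _)
  fromℤ-+ (+ m)    -[1+ n ] = fromℤ-⊖ m (suc n)
  fromℤ-+ (+ m)    (+ n)    = ×-homo-+ 1# m n

  fromℤ-neg : ∀ i → fromℤ (ℤ.- i) ≈ - fromℤ i
  fromℤ-neg -[1+ n ]    = sym (-‿involutive _)
  fromℤ-neg (+ zero)    = sym -0#≈0#
  fromℤ-neg (+ (suc n)) = refl

  fromℤ-homomorphism : ℤ.+-*-rawRing -Raw-AlmostCommutative⟶ fromCommutativeRing R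
  fromℤ-homomorphism = record
    { ⟦_⟧ = fromℤ ; +-homo = fromℤ-+ ; *-homo = fromℤ-* ; -‿homo = fromℤ-neg ; 0-homo = refl ; 1-homo = refl }

  fromℤ-equal? : ∀ i j → Maybe (fromℤ i ≈ fromℤ j)
  fromℤ-equal? i j with i ℤ.≟ j
  ... | yes i≡j = just (reflexive (≡.cong fromℤ i≡j))
  ... | no _    = nothing

  open import Algebra.Solver.Ring ℤ.+-*-rawRing (fromCommutativeRing R) fromℤ-homomorphism fromℤ-equal? public

module CoordinateSums {c ℓ : Level} (R : CommutativeRing c ℓ) where
  open CommutativeRing R
  open Cube R
  open IntegerCoefficientSolver R using (solve; _:+_; _:*_; _:-_; _:=_; con)
  open import Data.Fin using (Fin) renaming (zero to fzero; suc to fsuc)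
  open import Relation.Binary.Reasoning.Setoid setoid

  Σ-cong : ∀ d {f g : Fin d → Carrier} → (∀ i → f i ≈ g i) → Σ d f ≈ Σ d g
  Σ-cong zero    f≈g = refl
  Σ-cong (suc d) f≈g = +-cong (f≈g fzero) (Σ-cong d (λ i → f≈g (fsuc i)))

  Σ-quadratic : ∀ d k p q r (a : Point d) →
    Σ d (λ i → (k * p - a i * q) + (a i * a i) * r) ≈ (k * ⟦ d ⟧ * p - σ d a * q) + ‖ a ‖² * r
  Σ-quadratic zero k p q r a =
    solve 4 (λ k p q r → con (+ 0) := (k :* con (+ 0) :* p :- con (+ 0) :* q) :+ con (+ 0) :* r) refl k p q r
  Σ-quadratic (suc d) k p q r a = begin
    t (a fzero) + Σ d (λ i → t (a′ i))
      ≈⟨ +-congˡ (Σ-quadratic d k p q r a′) ⟩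
    t (a fzero) + ((k * ⟦ d ⟧ * p - σ d a′ * q) + ‖ a′ ‖² * r)
      ≈⟨ solve 8 (λ k p q r x D S Q →
           ((k :* p :- x :* q) :+ (x :* x) :* r) :+ ((k :* D :* p :- S :* q) :+ Q :* r)
           := (k :* (con (+ 1) :+ D) :* p :- (x :+ S) :* q) :+ (x :* x :+ Q) :* r)
         refl k p q r (a fzero) ⟦ d ⟧ (σ d a′) ‖ a′ ‖² ⟩
    (k * ⟦ suc d ⟧ * p - σ (suc d) a * q) + ‖ a ‖² * r ∎
    where
    a′ : Point d
    a′ i = a (fsuc i)

    t : Carrier → Carrier
    t x = (k * p - x * q) + (x * x) * r

module UniformVertices {c ℓ : Level} (R : CommutativeRing c ℓ) where
  open CommutativeRing R
  open Cube R
  open IntegerCoefficientSolver R using (solve; _:+_; _:*_; _:-_; :-_; _:=_; con)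
  open import Algebra.Properties.CommutativeSemigroup +-commutativeSemigroup using (interchange)
  open import Data.Bool using (Bool; true; false)
  open import Data.Fin using (Fin) renaming (zero to fzero; suc to fsuc)
  open import Data.Vec.Functional using (_∷_; []; head; tail)
  open import Relation.Binary.Reasoning.Setoid setoid

  ΣV-cong : ∀ d {f g : Vertex d → Carrier} → (∀ v → f v ≈ g v) → ΣV d f ≈ ΣV d g
  ΣV-cong zero    f≈g = f≈g []
  ΣV-cong (suc d) f≈g = +-cong (ΣV-cong d (λ v → f≈g (false ∷ v))) (ΣV-cong d (λ v → f≈g (true ∷ v)))

  ΣV-+ : ∀ d f g → ΣV d (λ v → f v + g v) ≈ ΣV d f + ΣV d g
  ΣV-+ zero    f g = refl
  ΣV-+ (suc d) f g = trans (+-cong (ΣV-+ d _ _) (ΣV-+ d _ _)) (interchange _ _ _ _)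

  ΣV-*ˡ : ∀ d k f → ΣV d (λ v → k * f v) ≈ k * ΣV d f
  ΣV-*ˡ zero    k f = refl
  ΣV-*ˡ (suc d) k f = trans (+-cong (ΣV-*ˡ d k _) (ΣV-*ˡ d k _)) (sym (distribˡ k _ _))

  module Moments (h : Carrier) (2h≈1 : (1# + 1#) * h ≈ 1#) where

    h*[x+x]≈x : ∀ x → h * (x + x) ≈ x
    h*[x+x]≈x x = begin
      h * (x + x)          ≈⟨ solve 2 (λ h x → h :* (x :+ x) := ((con (+ 1) :+ con (+ 1)) :* h) :* x) refl h x ⟩
      ((1# + 1#) * h) * x  ≈⟨ *-congʳ 2h≈1 ⟩
      1# * x               ≈⟨ *-identityˡ x ⟩
      x                    ∎

    mean₂ : Carrier → Carrier → Carrier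
    mean₂ x y = h * (x + y)

    var₂ : Carrier → Carrier → Carrier
    var₂ x y = mean₂ (x * x) (y * y) - mean₂ x y * mean₂ x y

    var₂≈square : ∀ x y → var₂ x y ≈ (h * (x - y)) * (h * (x - y))
    var₂≈square x y = begin
      h * (x * x + y * y) - mean₂ x y * mean₂ x y
        ≈⟨ +-congʳ (*-congˡ (trans (*-congʳ 2h≈1) (*-identityˡ _))) ⟨
      h * ((1# + 1#) * h * (x * x + y * y)) - mean₂ x y * mean₂ x y
        ≈⟨ solve 3 (λ h x y →
             h :* ((con (+ 1) :+ con (+ 1)) :* h :* (x :* x :+ y :* y)) :- (h :* (x :+ y)) :* (h :* (x :+ y))
             := (h :* (x :- y)) :* (h :* (x :- y)))
           refl h x y ⟩
      (h * (x - y)) * (h * (x - y)) ∎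

    mean : (d : ℕ) → (Vertex d → Carrier) → Carrier
    mean d f = (h ^ d) * ΣV d f

    variance : (d : ℕ) → (Vertex d → Carrier) → Carrier
    variance d f = mean d (λ v → (f v - mean d f) * (f v - mean d f))

    mean-cong : ∀ d {f g : Vertex d → Carrier} → (∀ v → f v ≈ g v) → mean d f ≈ mean d g
    mean-cong d f≈g = *-congˡ (ΣV-cong d f≈g)

    mean-suc : ∀ d f → mean (suc d) f ≈ mean₂ (mean d (λ v → f (false ∷ v))) (mean d (λ v → f (true ∷ v)))
    mean-suc d f = solve 4 (λ h p x y → (h :* p) :* (x :+ y) := h :* (p :* x :+ p :* y)) refl h (h ^ d) _ _

    mean-const : ∀ d k → mean d (λ _ → k) ≈ k
    mean-const zero    k = *-identityˡ k
    mean-const (suc d) k = begin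
      mean (suc d) (λ _ → k)                      ≈⟨ mean-suc d (λ _ → k) ⟩
      mean₂ (mean d (λ _ → k)) (mean d (λ _ → k)) ≈⟨ *-congˡ (+-cong (mean-const d k) (mean-const d k)) ⟩
      h * (k + k)                                 ≈⟨ h*[x+x]≈x k ⟩
      k                                           ∎

    mean-+ : ∀ d f g → mean d (λ v → f v + g v) ≈ mean d f + mean d g
    mean-+ d f g = trans (*-congˡ (ΣV-+ d f g)) (distribˡ (h ^ d) _ _)

    mean-*ˡ : ∀ d k f → mean d (λ v → k * f v) ≈ k * mean d f
    mean-*ˡ d k f = begin
      h ^ d * ΣV d (λ v → k * f v) ≈⟨ *-congˡ (ΣV-*ˡ d k f) ⟩
      h ^ d * (k * ΣV d f)         ≈⟨ x∙yz≈y∙xz (h ^ d) k (ΣV d f) ⟩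
      k * (h ^ d * ΣV d f)         ∎
      where open import Algebra.Properties.CommutativeSemigroup *-commutativeSemigroup using (x∙yz≈y∙xz)

    mean-affine : ∀ d g k f m → mean d (λ v → g v + (k * f v + m)) ≈ mean d g + (k * mean d f + m)
    mean-affine d g k f m = begin
      mean d (λ v → g v + (k * f v + m))          ≈⟨ mean-+ d g _ ⟩
      mean d g + mean d (λ v → k * f v + m)       ≈⟨ +-congˡ (mean-+ d _ _) ⟩
      mean d g + (mean d (λ v → k * f v) + mean d (λ _ → m))
                                                  ≈⟨ +-congˡ (+-cong (mean-*ˡ d k f) (mean-const d m)) ⟩
      mean d g + (k * mean d f + m)               ∎

    variance≈moments : ∀ d f → variance d f ≈ mean d (λ v → f v * f v) - mean d f * mean d f
    variance≈moments d f = begin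
      variance d f
        ≈⟨ mean-cong d (λ v → solve 2 (λ x μ → (x :- μ) :* (x :- μ) := x :* x :+ ((:- (μ :+ μ)) :* x :+ μ :* μ))
                                        refl (f v) μ) ⟩
      mean d (λ v → f v * f v + (- (μ + μ) * f v + μ * μ))
        ≈⟨ mean-affine d (λ v → f v * f v) (- (μ + μ)) f (μ * μ) ⟩
      mean d (λ v → f v * f v) + (- (μ + μ) * μ + μ * μ)
        ≈⟨ solve 2 (λ M μ → M :+ ((:- (μ :+ μ)) :* μ :+ μ :* μ) := M :- μ :* μ) refl _ μ ⟩
      mean d (λ v → f v * f v) - μ * μ ∎
      where μ = mean d f

    variance-cons : ∀ d (b : Bool → Carrier) (F : Vertex d → Carrier) →
      variance (suc d) (λ v → b (head v) + F (tail v)) ≈ var₂ (b false) (b true) + variance d F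
    variance-cons d b F = begin
      variance (suc d) F′
        ≈⟨ variance≈moments (suc d) F′ ⟩
      mean (suc d) (λ v → F′ v * F′ v) - mean (suc d) F′ * mean (suc d) F′
        ≈⟨ +-cong second-moment (-‿cong (*-cong first-moment first-moment)) ⟩
      mean₂ (M + ((b₀ + b₀) * μ + b₀ * b₀)) (M + ((b₁ + b₁) * μ + b₁ * b₁)) - (mean₂ b₀ b₁ + μ) * (mean₂ b₀ b₁ + μ)
        ≈⟨ solve 5 (λ h b₀ b₁ M μ →
             h :* ((M :+ ((b₀ :+ b₀) :* μ :+ b₀ :* b₀)) :+ (M :+ ((b₁ :+ b₁) :* μ :+ b₁ :* b₁)))
               :- (h :* (b₀ :+ b₁) :+ μ) :* (h :* (b₀ :+ b₁) :+ μ)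
             := (h :* (b₀ :* b₀ :+ b₁ :* b₁) :- (h :* (b₀ :+ b₁)) :* (h :* (b₀ :+ b₁))) :+ (h :* (M :+ M) :- μ :* μ))
           refl h b₀ b₁ M μ ⟩
      var₂ b₀ b₁ + (h * (M + M) - μ * μ)
        ≈⟨ +-congˡ (+-congʳ (h*[x+x]≈x M)) ⟩
      var₂ b₀ b₁ + (M - μ * μ)
        ≈⟨ +-congˡ (variance≈moments d F) ⟨
      var₂ b₀ b₁ + variance d F ∎
      where
      F′ : Vertex (suc d) → Carrier
      F′ v = b (head v) + F (tail v)
      b₀ = b false
      b₁ = b true
      μ = mean d F
      M = mean d (λ w → F w * F w)

      first-moment : mean (suc d) F′ ≈ mean₂ b₀ b₁ + μ
      first-moment = begin
        mean (suc d) F′                                 ≈⟨ mean-suc d F′ ⟩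
        mean₂ (mean d (λ w → b₀ + F w)) (mean d (λ w → b₁ + F w))
          ≈⟨ *-congˡ (+-cong (mean-+ d (λ _ → b₀) F) (mean-+ d (λ _ → b₁) F)) ⟩
        h * ((mean d (λ _ → b₀) + μ) + (mean d (λ _ → b₁) + μ))
          ≈⟨ *-congˡ (+-cong (+-congʳ (mean-const d b₀)) (+-congʳ (mean-const d b₁))) ⟩
        h * ((b₀ + μ) + (b₁ + μ))                       ≈⟨ *-congˡ (interchange b₀ μ b₁ μ) ⟩
        h * ((b₀ + b₁) + (μ + μ))                       ≈⟨ distribˡ h _ _ ⟩
        mean₂ b₀ b₁ + h * (μ + μ)                       ≈⟨ +-congˡ (h*[x+x]≈x μ) ⟩
        mean₂ b₀ b₁ + μ                                 ∎

      shifted-square : ∀ x → mean d (λ w → (x + F w) * (x + F w)) ≈ M + ((x + x) * μ + x * x)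
      shifted-square x = trans
        (mean-cong d (λ w → solve 2 (λ x y → (x :+ y) :* (x :+ y) := y :* y :+ ((x :+ x) :* y :+ x :* x)) refl x (F w)))
        (mean-affine d (λ w → F w * F w) (x + x) F (x * x))

      second-moment : mean (suc d) (λ v → F′ v * F′ v) ≈ mean₂ (M + ((b₀ + b₀) * μ + b₀ * b₀)) (M + ((b₁ + b₁) * μ + b₁ * b₁))
      second-moment = trans (mean-suc d (λ v → F′ v * F′ v)) (*-congˡ (+-cong (shifted-square b₀) (shifted-square b₁)))

    separable : (d : ℕ) → (Fin d → Bool → Carrier) → Vertex d → Carrier
    separable d g v = Σ d (λ i → g i (v i))

    variance-separable : ∀ d g → variance d (separable d g) ≈ Σ d (λ i → var₂ (g i false) (g i true))
    variance-separable zero g =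
      solve 0 (con (+ 1) :* ((con (+ 0) :- con (+ 1) :* con (+ 0)) :* (con (+ 0) :- con (+ 1) :* con (+ 0))) := con (+ 0)) refl
    variance-separable (suc d) g =
      trans (variance-cons d (g fzero) (separable d (λ i → g (fsuc i))))
            (+-congˡ (variance-separable d (λ i → g (fsuc i))))

    var₂-squared-distances : ∀ n x →
      var₂ ((0# - x) * (0# - x)) ((n - x) * (n - x)) ≈ ((h * h) * (n ^ 4) - x * (n ^ 3)) + (x * x) * (n ^ 2)
    var₂-squared-distances n x = begin
      var₂ u w                                 ≈⟨ var₂≈square u w ⟩
      (h * (u - w)) * (h * (u - w))            ≈⟨ *-cong half-gap half-gap ⟩
      (x * n - h * (n * n)) * (x * n - h * (n * n))
        ≈⟨ solve 3 (λ h n x →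
             (x :* n :- h :* (n :* n)) :* (x :* n :- h :* (n :* n))
             := ((h :* h) :* (n :* (n :* (n :* (n :* con (+ 1))))) :- h :* (x :* (n :* (n :* (n :* con (+ 1)))) :+ x :* (n :* (n :* (n :* con (+ 1)))))) :+ (x :* x) :* (n :* (n :* con (+ 1))))
           refl h n x ⟩
      ((h * h) * (n ^ 4) - h * (x * (n ^ 3) + x * (n ^ 3))) + (x * x) * (n ^ 2)
        ≈⟨ +-congʳ (+-congˡ (-‿cong (h*[x+x]≈x (x * (n ^ 3))))) ⟩
      ((h * h) * (n ^ 4) - x * (n ^ 3)) + (x * x) * (n ^ 2) ∎
      where
      u = (0# - x) * (0# - x)
      w = (n - x) * (n - x)
      half-gap : h * (u - w) ≈ x * n - h * (n * n)
      half-gap = begin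
        h * (u - w)
          ≈⟨ solve 3 (λ h n x →
               h :* ((con (+ 0) :- x) :* (con (+ 0) :- x) :- (n :- x) :* (n :- x))
               := h :* (x :* n :+ x :* n) :- h :* (n :* n))
             refl h n x ⟩
        h * (x * n + x * n) - h * (n * n)  ≈⟨ +-congʳ (h*[x+x]≈x (x * n)) ⟩
        x * n - h * (n * n)                ∎

lemma2p2 : {c ℓ : Level} (R : CommutativeRing c ℓ) →
    let open CommutativeRing R in let open Cube R in
    (h : Carrier) → (1# + 1#) * h ≈ 1# →
    (d N : ℕ) → 1 ≤ d → 1 ≤ N → (a : Point d) →
    Var h d N a ≈ ((h * h) * ⟦ d ⟧ * (⟦ N ⟧ ^ 4) - σ d a * (⟦ N ⟧ ^ 3)) + ‖ a ‖² * (⟦ N ⟧ ^ 2)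
-- The identity also holds for d = 0 and N = 0, so the positivity hypotheses are unused.
lemma2p2 R h 2h≈1 d N _ _ a = begin
  -- Var unfolds to the variance of v ↦ dist²(vertex v, a), a separable function of v.
  Var h d N a
    ≈⟨ variance-separable d (λ i b → (coordinate b - a i) * (coordinate b - a i)) ⟩
  Σ d (λ i → var₂ ((0# - a i) * (0# - a i)) ((⟦ N ⟧ - a i) * (⟦ N ⟧ - a i)))
    ≈⟨ Σ-cong d (λ i → var₂-squared-distances ⟦ N ⟧ (a i)) ⟩
  Σ d (λ i → ((h * h) * (⟦ N ⟧ ^ 4) - a i * (⟦ N ⟧ ^ 3)) + (a i * a i) * (⟦ N ⟧ ^ 2))
    ≈⟨ Σ-quadratic d (h * h) (⟦ N ⟧ ^ 4) (⟦ N ⟧ ^ 3) (⟦ N ⟧ ^ 2) a ⟩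
  ((h * h) * ⟦ d ⟧ * (⟦ N ⟧ ^ 4) - σ d a * (⟦ N ⟧ ^ 3)) + ‖ a ‖² * (⟦ N ⟧ ^ 2) ∎
  where
  open CommutativeRing R
  open Cube R
  open CoordinateSums R
  open UniformVertices.Moments R h 2h≈1
  open import Relation.Binary.Reasoning.Setoid setoid
  open import Data.Bool using (Bool; if_then_else_)

  coordinate : Bool → Carrier
  coordinate b = if b then ⟦ N ⟧ else 0#
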